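{- There exists an $AP_3$-covering sequence $A$ of nonnegative integers such that $$\limsup_{n\to\infty}\frac{A(n)}{\sqrt n}=\sqrt{15}.$$
   Context: A sequence (set) $A$ of nonnegative integers is called an $AP_k$-covering sequence if there exists an integer $n_0$ such that for every integer $n>n_0$ there exist $a_1,\dots,a_{k-1}\in A$ with $a_1<a_2<\cdots<a_{k-1}<n$ such that $a_1,\dots,a_{k-1},n$ form a $k$-term arithmetic progression. For a set $A$ of nonnegative integers, $A(n)$ denotes the number of elements of $A$ that are at most $n$, i.e. $A(n)=|\{a\in A: a\le n\}|$. -}

module Defs where

open import Data.Nat using (ℕ; zero; suc; _+_; _*_; _<_; _>_)
open import Data.Bool using (Bool; true; false)
open import Data.Product using (Σ; ∃; _×_; _,_)
open import Relation.Binary.PropositionalEquality using (_≡_)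

Seq : Set
Seq = ℕ → Bool

_∈_ : ℕ → Seq → Set
a ∈ A = A a ≡ true

count : Seq → ℕ → ℕ
count A zero = if0 (A zero)
  where
  if0 : Bool → ℕ
  if0 true = 1
  if0 false = 0
count A (suc n) = bit (A (suc n)) + count A n
  where
  bit : Bool → ℕ
  bit true = 1
  bit false = 0

-- a₁ < a₂ < n form a 3-term AP iff a₂ - a₁ = n - a₂, i.e. a₁ + n = 2 a₂.
AP3-covering : Seq → Set
AP3-covering A =
  ∃ λ n₀ → ∀ n → n > n₀ →
    ∃ λ a₁ → ∃ λ a₂ →
      a₁ ∈ A × a₂ ∈ A × a₁ < a₂ × a₂ < n × a₁ + n ≡ 2 * a₂

-- limsup_{n→∞} A(n)/√n = √15, expressed via rational thresholds p/r (r > 0):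
-- (i) for every p/r > √15 (i.e. p² > 15 r²), eventually A(n)/√n < p/r,
--     i.e. r² A(n)² < p² n;
-- (ii) for every p/r < √15 (i.e. p² < 15 r²), infinitely often A(n)/√n > p/r,
--     i.e. r² A(n)² > p² n.
LimsupSqrt15 : Seq → Set
LimsupSqrt15 A =
  (∀ p r → r > 0 → p * p > 15 * (r * r) →
     ∃ λ N → ∀ n → n > N →
       (r * r) * (count A n * count A n) < (p * p) * n)
  × (∀ p r → r > 0 → p * p < 15 * (r * r) →
     ∀ N → ∃ λ n → n > N ×
       (r * r) * (count A n * count A n) > (p * p) * n)

-- Write R = x + 8 for a scale x; the scales 0, 8, 24, … (x ↦ 2x + 8) double R. At scale x the set
-- contains the multiples of τ = 128R + 1 in τ·[L, H], and a window [E, μ] ending at μ = 93615R² = U²/15,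
-- U = 1185R, filled greedily so that the count rises to exactly U at μ without exceeding √(15n).
-- After μ the count stays U until the next block starts and then grows by at most one per period τ′,
-- so τ′·A(n) ≤ D + n; (D + n)² ≤ 15τ′²n holds at both ends of that stretch and hence, by convexity,
-- in between. So A(n)² ≤ 15n from μ₀ on, with equality at every μ.
-- For covering, n ∈ [β(x), β(2x + 8)) is paired with a₁ = τu from the block at x chosen so that
-- 2τ′ ∣ a₁ + n (τ is invertible modulo 2τ′); then a₂ = (a₁ + n)/2 = τ′Z lies in the next block.

{-# OPTIONS --safe #-}
module Submission where

open import Data.Nat
open import Data.Nat.Properties
open import Data.Nat.DivMod
open import Data.Nat.Divisibility using (_∣_; _∣?_; divides; ∣m+n∣m⇒∣n; ∣n⇒∣m*n; m∣m*n)
open import Data.Nat.Tactic.RingSolver using (solve-∀)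
open import Data.Bool using (true; false; if_then_else_)
import Data.Bool.Properties as Bool
open import Data.List using (List; []; _∷_)
open import Data.Product using (∃; _×_; _,_; proj₁; proj₂)
open import Data.Sum using (_⊎_; inj₁; inj₂)
open import Data.Empty using (⊥-elim)
open import Function.Bundles using (_⇔_; mk⇔; Equivalence)
open import Relation.Nullary using (¬_; Dec; yes; no; does; contradiction)
open import Relation.Nullary.Decidable using (_×-dec_; _⊎-dec_; dec-true)
open import Relation.Binary.PropositionalEquality
open import Relation.Binary.Definitions using (tri<; tri≈; tri>)
open import Defs

-- Polynomials over ℕ

Poly : Set
Poly = List ℕ

-- Constant term last: conversion checking then never unfolds a large literal coefficient.
eval : Poly → ℕ → ℕ
eval []      x = 0
eval (c ∷ p) x = x * eval p x + c

infixl 6 _⊕_ _⊖_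
infixl 7 _⊗_

_⊕_ : Poly → Poly → Poly
[]      ⊕ q       = q
(c ∷ p) ⊕ []      = c ∷ p
(c ∷ p) ⊕ (d ∷ q) = c + d ∷ p ⊕ q

_⊖_ : Poly → Poly → Poly
[]      ⊖ q       = []
(c ∷ p) ⊖ []      = c ∷ p
(c ∷ p) ⊖ (d ∷ q) = c ∸ d ∷ p ⊖ q

smul : ℕ → Poly → Poly
smul a []      = []
smul a (c ∷ p) = a * c ∷ smul a p

_⊗_ : Poly → Poly → Poly
[]      ⊗ q = []
(c ∷ p) ⊗ q = smul c q ⊕ (0 ∷ p ⊗ q)

_⊚_ : Poly → Poly → Poly
[]      ⊚ q = []
(c ∷ p) ⊚ q = (c ∷ []) ⊕ q ⊗ (p ⊚ q)

trim : Poly → Poly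
trim []      = []
trim (c ∷ p) with trim p
... | []    with c
...   | zero  = []
...   | suc _ = c ∷ []
trim (c ∷ p) | q ∷ qs = c ∷ q ∷ qs

eval-⊕ : ∀ p q x → eval (p ⊕ q) x ≡ eval p x + eval q x
eval-⊕ []      q       x = refl
eval-⊕ (c ∷ p) []      x = sym (+-identityʳ _)
eval-⊕ (c ∷ p) (d ∷ q) x rewrite eval-⊕ p q x = shuffle c d x (eval p x) (eval q x)
  where
  shuffle : ∀ c d x a b → x * (a + b) + (c + d) ≡ x * a + c + (x * b + d)
  shuffle = solve-∀

eval-smul : ∀ a p x → eval (smul a p) x ≡ a * eval p x
eval-smul a []      x = sym (*-zeroʳ a)
eval-smul a (c ∷ p) x rewrite eval-smul a p x = shuffle a c x (eval p x)
  where
  shuffle : ∀ a c x e → x * (a * e) + a * c ≡ a * (x * e + c)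
  shuffle = solve-∀

eval-⊗ : ∀ p q x → eval (p ⊗ q) x ≡ eval p x * eval q x
eval-⊗ []      q x = refl
eval-⊗ (c ∷ p) q x
  rewrite eval-⊕ (smul c q) (0 ∷ p ⊗ q) x | eval-smul c q x | eval-⊗ p q x
  = shuffle c x (eval p x) (eval q x)
  where
  shuffle : ∀ c x a b → c * b + (x * (a * b) + 0) ≡ (x * a + c) * b
  shuffle = solve-∀

eval-⊚ : ∀ p q x → eval (p ⊚ q) x ≡ eval p (eval q x)
eval-⊚ []      q x = refl
eval-⊚ (c ∷ p) q x
  rewrite eval-⊕ (c ∷ []) (q ⊗ (p ⊚ q)) x | eval-⊗ q (p ⊚ q) x | eval-⊚ p q x
  = trans (cong (λ z → z + c + eval q x * eval p (eval q x)) (*-zeroʳ x)) (+-comm c _)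

eval-trim : ∀ p x → eval (trim p) x ≡ eval p x
eval-trim []      x = refl
eval-trim (c ∷ p) x with trim p | eval-trim p x
... | [] | e with c
...   | zero  = trans (sym (*-zeroʳ x)) (trans (cong (x *_) e) (sym (+-identityʳ _)))
...   | suc n = cong (λ v → x * v + suc n) e
eval-trim (c ∷ p) x | q ∷ qs | e = cong (λ v → x * v + c) e

eval-mono : ∀ p {x y} → x ≤ y → eval p x ≤ eval p y
eval-mono []      x≤y = ≤-refl
eval-mono (c ∷ p) x≤y = +-monoˡ-≤ c (*-mono-≤ x≤y (eval-mono p x≤y))

infixl 6 _+ₑ_
infixl 7 _*ₑ_

data Expr : Set where
  var   : Expr
  lit   : ℕ → Expr
  _⟨_⟩  : Poly → Expr → Expr
  _+ₑ_  : Expr → Expr → Expr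
  _*ₑ_  : Expr → Expr → Expr

⟦_⟧ : Expr → ℕ → ℕ
⟦ var ⟧     x = x
⟦ lit c ⟧   x = c
⟦ p ⟨ e ⟩ ⟧ x = eval p (⟦ e ⟧ x)
⟦ e +ₑ f ⟧  x = ⟦ e ⟧ x + ⟦ f ⟧ x
⟦ e *ₑ f ⟧  x = ⟦ e ⟧ x * ⟦ f ⟧ x

normal : Expr → Poly
normal var       = 0 ∷ 1 ∷ []
normal (lit c)   = c ∷ []
normal (p ⟨ e ⟩) = p ⊚ normal e
normal (e +ₑ f)  = normal e ⊕ normal f
normal (e *ₑ f)  = normal e ⊗ normal f

eval-normal : ∀ e x → eval (normal e) x ≡ ⟦ e ⟧ x
eval-normal var       x = trans (+-identityʳ _) (trans (cong (λ v → x * (v + 1)) (*-zeroʳ x)) (*-identityʳ x))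
eval-normal (lit c)   x = cong (_+ c) (*-zeroʳ x)
eval-normal (p ⟨ e ⟩) x = trans (eval-⊚ p (normal e) x) (cong (eval p) (eval-normal e x))
eval-normal (e +ₑ f)  x = trans (eval-⊕ (normal e) (normal f) x) (cong₂ _+_ (eval-normal e x) (eval-normal f x))
eval-normal (e *ₑ f)  x = trans (eval-⊗ (normal e) (normal f) x) (cong₂ _*_ (eval-normal e x) (eval-normal f x))

poly-≡ : ∀ e f → trim (normal e) ≡ trim (normal f) → ∀ x → ⟦ e ⟧ x ≡ ⟦ f ⟧ x
poly-≡ e f same x = begin
  ⟦ e ⟧ x                    ≡⟨ sym (eval-normal e x) ⟩
  eval (normal e) x          ≡⟨ sym (eval-trim (normal e) x) ⟩
  eval (trim (normal e)) x   ≡⟨ cong (λ p → eval p x) same ⟩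
  eval (trim (normal f)) x   ≡⟨ eval-trim (normal f) x ⟩
  eval (normal f) x          ≡⟨ eval-normal f x ⟩
  ⟦ f ⟧ x                    ∎
  where open ≡-Reasoning

-- With truncated subtraction, p ≤ₚ q holds exactly when every coefficient of p
-- is at most the corresponding coefficient of q.
_≤ₚ_ : Poly → Poly → Set
p ≤ₚ q = trim q ≡ trim (p ⊕ (q ⊖ p))

poly-≤ : ∀ e f → normal e ≤ₚ normal f → ∀ x → ⟦ e ⟧ x ≤ ⟦ f ⟧ x
poly-≤ e f dominated x = begin
  ⟦ e ⟧ x                                      ≡⟨ sym (eval-normal e x) ⟩
  eval (normal e) x                            ≤⟨ m≤m+n _ _ ⟩
  eval (normal e) x + eval (normal f ⊖ normal e) x ≡⟨ sym (eval-⊕ (normal e) _ x) ⟩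
  eval (normal e ⊕ (normal f ⊖ normal e)) x    ≡⟨ sym (eval-trim (normal e ⊕ _) x) ⟩
  eval (trim (normal e ⊕ (normal f ⊖ normal e))) x ≡⟨ cong (λ p → eval p x) (sym dominated) ⟩
  eval (trim (normal f)) x                     ≡⟨ eval-trim (normal f) x ⟩
  eval (normal f) x                            ≡⟨ eval-normal f x ⟩
  ⟦ f ⟧ x                                      ∎
  where open ≤-Reasoning

poly-< : ∀ e f → normal (lit 1 +ₑ e) ≤ₚ normal f → ∀ x → ⟦ e ⟧ x < ⟦ f ⟧ x
poly-< e f = poly-≤ (lit 1 +ₑ e) f

-- The parameters at scale x, with R = x + 8 and primes denoting the next scale:
-- next = 2R − 8, τ = 128R + 1, L = 183R, H = 728R + 2, U = 1185R, μ = 93615R² = U²/15,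
-- ε = μ − U − 1, ν = 79R − 1, α = 366R − 1 = L′ − 1, δ = 819R + 1 = U − α, β = 163840R²,
-- ι = 256R + 3, κ = 64R + 1 (so τι = 1 + 2τ′κ) and u₀ = 192R.

nextₚ τₚ Lₚ Hₚ Uₚ μₚ εₚ νₚ αₚ δₚ βₚ ιₚ κₚ u₀ₚ : Poly
nextₚ = 8 ∷ 2 ∷ []
τₚ    = 1025 ∷ 128 ∷ []
Lₚ    = 1464 ∷ 183 ∷ []
Hₚ    = 5826 ∷ 728 ∷ []
Uₚ    = 9480 ∷ 1185 ∷ []
μₚ    = 5991360 ∷ 1497840 ∷ 93615 ∷ []
εₚ    = 5981879 ∷ 1496655 ∷ 93615 ∷ []
νₚ    = 631 ∷ 79 ∷ []
αₚ    = 2927 ∷ 366 ∷ []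
δₚ    = 6553 ∷ 819 ∷ []
βₚ    = 10485760 ∷ 2621440 ∷ 163840 ∷ []
ιₚ    = 2051 ∷ 256 ∷ []
κₚ    = 513 ∷ 64 ∷ []
u₀ₚ   = 1536 ∷ 192 ∷ []

next τ L H U μ ε ν α δ β ι κ u₀ E lo hi : ℕ → ℕ
next = eval nextₚ
τ    = eval τₚ
L    = eval Lₚ
H    = eval Hₚ
U    = eval Uₚ
μ    = eval μₚ
ε    = eval εₚ
ν    = eval νₚ
α    = eval αₚ
δ    = eval δₚ
β    = eval βₚ
ι    = eval ιₚ
κ    = eval κₚ
u₀   = eval u₀ₚ
E x  = suc (ε x)
lo x = τ x * L x
hi x = τ x * H x

⌜_⌝ ⌜_⌝⁺ : Poly → Expr
⌜ p ⌝  = p ⟨ var ⟩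
⌜ p ⌝⁺ = p ⟨ ⌜ nextₚ ⌝ ⟩

Eₑ Eₑ⁺ : Expr
Eₑ  = lit 1 +ₑ ⌜ εₚ ⌝
Eₑ⁺ = lit 1 +ₑ ⌜ εₚ ⌝⁺

τ-positive : ∀ x → 0 < τ x
τ-positive = poly-< (lit 0) ⌜ τₚ ⌝ refl

τ-nonZero : ∀ x → NonZero (τ x)
τ-nonZero x = >-nonZero (τ-positive x)

hi<E : ∀ x → hi x < E x
hi<E = poly-< (⌜ τₚ ⌝ *ₑ ⌜ Hₚ ⌝) Eₑ refl

μ<lo-next : ∀ x → μ x < lo (next x)
μ<lo-next = poly-< ⌜ μₚ ⌝ (⌜ τₚ ⌝⁺ *ₑ ⌜ Lₚ ⌝⁺) refl

μ≡1+U+ε : ∀ x → μ x ≡ suc (U x + ε x)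
μ≡1+U+ε = poly-≡ ⌜ μₚ ⌝ (lit 1 +ₑ ⌜ Uₚ ⌝ +ₑ ⌜ εₚ ⌝) refl

U²≡15μ : ∀ x → U x * U x ≡ 15 * μ x
U²≡15μ = poly-≡ (⌜ Uₚ ⌝ *ₑ ⌜ Uₚ ⌝) (lit 15 *ₑ ⌜ μₚ ⌝) refl

ν*U≡E : ∀ x → ν x * U x ≡ E x
ν*U≡E = poly-≡ (⌜ νₚ ⌝ *ₑ ⌜ Uₚ ⌝) Eₑ refl

U≡15*[1+ν] : ∀ x → U x ≡ 15 * suc (ν x)
U≡15*[1+ν] = poly-≡ ⌜ Uₚ ⌝ (lit 15 *ₑ (lit 1 +ₑ ⌜ νₚ ⌝)) refl

μ≤τ′α : ∀ x → μ x ≤ τ (next x) * α x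
μ≤τ′α = poly-≤ ⌜ μₚ ⌝ (⌜ τₚ ⌝⁺ *ₑ ⌜ αₚ ⌝) refl

τ′α<E′ : ∀ x → τ (next x) * α x < E (next x)
τ′α<E′ = poly-< (⌜ τₚ ⌝⁺ *ₑ ⌜ αₚ ⌝) Eₑ⁺ refl

L′≡1+α : ∀ x → L (next x) ≡ suc (α x)
L′≡1+α = poly-≡ ⌜ Lₚ ⌝⁺ (lit 1 +ₑ ⌜ αₚ ⌝) refl

U≡δ+α : ∀ x → U x ≡ δ x + α x
U≡δ+α = poly-≡ ⌜ Uₚ ⌝ (⌜ δₚ ⌝ +ₑ ⌜ αₚ ⌝) refl

quiet-start-bound : ∀ x → let t = τ (next x) in
  (t * δ x + t * α x) * (t * δ x + t * α x) ≤ 15 * (t * t) * (t * α x)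
quiet-start-bound = poly-≤ ((⌜ τₚ ⌝⁺ *ₑ ⌜ δₚ ⌝ +ₑ ⌜ τₚ ⌝⁺ *ₑ ⌜ αₚ ⌝) *ₑ (⌜ τₚ ⌝⁺ *ₑ ⌜ δₚ ⌝ +ₑ ⌜ τₚ ⌝⁺ *ₑ ⌜ αₚ ⌝))
                           (lit 15 *ₑ (⌜ τₚ ⌝⁺ *ₑ ⌜ τₚ ⌝⁺) *ₑ (⌜ τₚ ⌝⁺ *ₑ ⌜ αₚ ⌝)) refl

window-start-bound : ∀ x → let t = τ (next x) in
  (t * δ x + E (next x)) * (t * δ x + E (next x)) ≤ 15 * (t * t) * E (next x)
window-start-bound = poly-≤ ((⌜ τₚ ⌝⁺ *ₑ ⌜ δₚ ⌝ +ₑ Eₑ⁺) *ₑ (⌜ τₚ ⌝⁺ *ₑ ⌜ δₚ ⌝ +ₑ Eₑ⁺))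
                            (lit 15 *ₑ (⌜ τₚ ⌝⁺ *ₑ ⌜ τₚ ⌝⁺) *ₑ Eₑ⁺) refl

x<next : ∀ x → x < next x
x<next = poly-< var ⌜ nextₚ ⌝ refl

x<μ : ∀ x → x < μ x
x<μ = poly-< var ⌜ μₚ ⌝ refl

x<β : ∀ x → x < β x
x<β = poly-< var ⌜ βₚ ⌝ refl

x≤lo : ∀ x → x ≤ lo x
x≤lo = poly-≤ var (⌜ τₚ ⌝ *ₑ ⌜ Lₚ ⌝) refl

L≤H : ∀ x → L x ≤ H x
L≤H = poly-≤ ⌜ Lₚ ⌝ ⌜ Hₚ ⌝ refl

x≤E : ∀ x → x ≤ E x
x≤E = poly-≤ var Eₑ refl

τι≡1+2τ′κ : ∀ x → τ x * ι x ≡ 1 + 2 * τ (next x) * κ x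
τι≡1+2τ′κ = poly-≡ (⌜ τₚ ⌝ *ₑ ⌜ ιₚ ⌝) (lit 1 +ₑ lit 2 *ₑ ⌜ τₚ ⌝⁺ *ₑ ⌜ κₚ ⌝) refl

L≤u₀ : ∀ x → L x ≤ u₀ x
L≤u₀ = poly-≤ ⌜ Lₚ ⌝ ⌜ u₀ₚ ⌝ refl

u₀+2τ′≤H : ∀ x → u₀ x + 2 * τ (next x) ≤ H x
u₀+2τ′≤H = poly-≤ (⌜ u₀ₚ ⌝ +ₑ lit 2 *ₑ ⌜ τₚ ⌝⁺) ⌜ Hₚ ⌝ refl

τ[u₀+2τ′]<β : ∀ x → τ x * (u₀ x + 2 * τ (next x)) < β x
τ[u₀+2τ′]<β = poly-< (⌜ τₚ ⌝ *ₑ (⌜ u₀ₚ ⌝ +ₑ lit 2 *ₑ ⌜ τₚ ⌝⁺)) ⌜ βₚ ⌝ refl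

2τ′L′≤β+τu₀ : ∀ x → 2 * τ (next x) * L (next x) ≤ β x + τ x * u₀ x
2τ′L′≤β+τu₀ = poly-≤ (lit 2 *ₑ ⌜ τₚ ⌝⁺ *ₑ ⌜ Lₚ ⌝⁺) (⌜ βₚ ⌝ +ₑ ⌜ τₚ ⌝ *ₑ ⌜ u₀ₚ ⌝) refl

β′+τ[u₀+2τ′]≤2τ′[H′+1] : ∀ x → β (next x) + τ x * (u₀ x + 2 * τ (next x)) ≤ 2 * τ (next x) * (H (next x) + 1)
β′+τ[u₀+2τ′]≤2τ′[H′+1] = poly-≤ (⌜ βₚ ⌝⁺ +ₑ ⌜ τₚ ⌝ *ₑ (⌜ u₀ₚ ⌝ +ₑ lit 2 *ₑ ⌜ τₚ ⌝⁺))
                                 (lit 2 *ₑ ⌜ τₚ ⌝⁺ *ₑ (⌜ Hₚ ⌝⁺ +ₑ lit 1)) refl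

-- Counting

count-suc-∈ : ∀ (A : Seq) n → suc n ∈ A → count A (suc n) ≡ suc (count A n)
count-suc-∈ A n ∈A rewrite ∈A = refl

count-suc-∉ : ∀ (A : Seq) n → ¬ suc n ∈ A → count A (suc n) ≡ count A n
count-suc-∉ A n ∉A with A (suc n)
... | true  = ⊥-elim (∉A refl)
... | false = refl

count-unchanged : ∀ (A : Seq) {a b} → a ≤ b → (∀ y → a < y → y ≤ b → ¬ y ∈ A) →
                  count A b ≡ count A a
count-unchanged A {b = zero}  z≤n   none = refl
count-unchanged A {b = suc b} a≤1+b none with m≤n⇒m<n∨m≡n a≤1+b
... | inj₂ refl        = refl
... | inj₁ (s≤s a≤b)   = trans (count-suc-∉ A b (none (suc b) (s≤s a≤b) ≤-refl))
                               (count-unchanged A a≤b λ y a<y y≤b → none y a<y (m≤n⇒m≤1+n y≤b))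

∣1+m⇒m/n<[1+m]/n : ∀ {m n} .{{_ : NonZero n}} → n ∣ suc m → m / n < suc m / n
∣1+m⇒m/n<[1+m]/n {m} {n} (divides q 1+m≡qn) = begin-strict
  m / n       <⟨ m<n*o⇒m/o<n (subst (m <_) 1+m≡qn ≤-refl) ⟩
  q           ≡⟨ sym (m*n/n≡m q n) ⟩
  q * n / n   ≡⟨ /-congˡ (sym 1+m≡qn) ⟩
  suc m / n   ∎
  where open ≤-Reasoning

count-multiples : ∀ (A : Seq) t .{{_ : NonZero t}} {a b} → a ≤ b →
                  (∀ y → a < y → y ≤ b → y ∈ A → t ∣ y) →
                  count A b + a / t ≤ count A a + b / t
count-multiples A t {b = zero}  z≤n   mult = ≤-refl
count-multiples A t {a} {suc b} a≤1+b mult with m≤n⇒m<n∨m≡n a≤1+b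
... | inj₂ refl      = ≤-refl
... | inj₁ (s≤s a≤b) with count-multiples A t a≤b (λ y a<y y≤b → mult y a<y (m≤n⇒m≤1+n y≤b))
                       | A (suc b) Bool.≟ true
...   | ih | yes ∈A = begin
  count A (suc b) + a / t       ≡⟨ cong (_+ a / t) (count-suc-∈ A b ∈A) ⟩
  suc (count A b + a / t)       ≤⟨ s≤s ih ⟩
  suc (count A a + b / t)       ≡⟨ sym (+-suc (count A a) (b / t)) ⟩
  count A a + suc (b / t)       ≤⟨ +-monoʳ-≤ (count A a) (∣1+m⇒m/n<[1+m]/n (mult (suc b) (s≤s a≤b) ≤-refl ∈A)) ⟩
  count A a + suc b / t         ∎
  where open ≤-Reasoning
...   | ih | no ∉A = begin
  count A (suc b) + a / t       ≡⟨ cong (_+ a / t) (count-suc-∉ A b ∉A) ⟩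
  count A b + a / t             ≤⟨ ih ⟩
  count A a + b / t             ≤⟨ +-monoʳ-≤ (count A a) (/-monoˡ-≤ t (n≤1+n b)) ⟩
  count A a + suc b / t         ∎
  where open ≤-Reasoning

-- `weighted` is the convexity of (D + n)² − κn at a, a + e, a + e + f, arranged without subtraction.
square-bound-between : ∀ D κ {a n b} → a ≤ n → n ≤ b →
  (D + a) * (D + a) ≤ κ * a → (D + b) * (D + b) ≤ κ * b → (D + n) * (D + n) ≤ κ * n
square-bound-between D κ {a} {n} {b} a≤n n≤b at-a at-b
  with n ∸ a | m+[n∸m]≡n a≤n | b ∸ n | m+[n∸m]≡n n≤b
... | zero  | refl | f | refl = subst (λ z → (D + z) * (D + z) ≤ κ * z) (sym (+-identityʳ a)) at-a
... | suc e | refl | f | refl = *-cancelˡ-≤ (suc e + f) (begin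
  (suc e + f) * ((D + (a + suc e)) * (D + (a + suc e)))
    ≤⟨ m≤m+n _ _ ⟩
  (suc e + f) * ((D + (a + suc e)) * (D + (a + suc e))) + suc e * f * (suc e + f)
    ≡⟨ weighted D a (suc e) f ⟩
  f * ((D + a) * (D + a)) + suc e * ((D + (a + suc e + f)) * (D + (a + suc e + f)))
    ≤⟨ +-mono-≤ (*-monoʳ-≤ f at-a) (*-monoʳ-≤ (suc e) at-b) ⟩
  f * (κ * a) + suc e * (κ * (a + suc e + f))
    ≡⟨ linear κ a (suc e) f ⟩
  (suc e + f) * (κ * (a + suc e)) ∎)
  where
  open ≤-Reasoning
  weighted : ∀ D a e f → (e + f) * ((D + (a + e)) * (D + (a + e))) + e * f * (e + f)
                         ≡ f * ((D + a) * (D + a)) + e * ((D + (a + e + f)) * (D + (a + e + f)))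
  weighted = solve-∀
  linear : ∀ κ a e f → f * (κ * a) + e * (κ * (a + e + f)) ≡ (e + f) * (κ * (a + e))
  linear = solve-∀

j²≤15[νU+j] : ∀ ν U j → U ≡ 15 * suc ν → j ≤ U → j * j ≤ 15 * (ν * U + j)
j²≤15[νU+j] ν U j U≡ j≤U = begin
  j * j                ≤⟨ *-monoˡ-≤ j j≤U ⟩
  U * j                ≡⟨ cong (_* j) U≡ ⟩
  15 * suc ν * j       ≡⟨ distribute ν j ⟩
  15 * (ν * j + j)     ≤⟨ *-monoʳ-≤ 15 (+-monoˡ-≤ j (*-monoʳ-≤ ν j≤U)) ⟩
  15 * (ν * U + j)     ∎
  where
  open ≤-Reasoning
  distribute : ∀ ν j → 15 * suc ν * j ≡ 15 * (ν * j + j)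
  distribute = solve-∀

bracket : ∀ (f : ℕ → ℕ) → (∀ k → k < f k) → ∀ n → f 0 ≤ n → ∃ λ j → f j ≤ n × n < f (suc j)
bracket f unbounded n f0≤n = search (suc n) 0 f0≤n (<-trans (n<1+n n) (unbounded (suc n)))
  where
  search : ∀ d k → f k ≤ n → n < f (k + d) → ∃ λ j → f j ≤ n × n < f (suc j)
  search zero    k fk≤n n<fk = ⊥-elim (<⇒≱ (subst (λ i → n < f i) (+-identityʳ k) n<fk) fk≤n)
  search (suc d) k fk≤n n<f[k+1+d] with n <? f (suc k)
  ... | yes n<f[1+k] = k , fk≤n , n<f[1+k]
  ... | no  n≮f[1+k] = search d (suc k) (≮⇒≥ n≮f[1+k]) (subst (λ i → n < f i) (+-suc k d) n<f[k+1+d])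

limsup-sqrt15 : ∀ (A : Seq) N₀ →
  (∀ n → N₀ < n → count A n * count A n ≤ 15 * n) →
  (∀ N → ∃ λ n → N < n × count A n * count A n ≡ 15 * n) →
  LimsupSqrt15 A
limsup-sqrt15 A N₀ bounded attained = eventually-below , infinitely-above
  where
  rearrange : ∀ r n → r * r * (15 * n) ≡ 15 * (r * r) * n
  rearrange = solve-∀
  eventually-below : ∀ p r → r > 0 → p * p > 15 * (r * r) →
    ∃ λ N → ∀ n → n > N → r * r * (count A n * count A n) < p * p * n
  eventually-below p r _ 15r²<p² = N₀ , λ n N₀<n → begin-strict
    r * r * (count A n * count A n) ≤⟨ *-monoʳ-≤ (r * r) (bounded n N₀<n) ⟩
    r * r * (15 * n)                ≡⟨ rearrange r n ⟩
    15 * (r * r) * n                <⟨ *-monoˡ-< n {{>-nonZero (≤-<-trans z≤n N₀<n)}} 15r²<p² ⟩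
    p * p * n                       ∎
    where open ≤-Reasoning
  infinitely-above : ∀ p r → r > 0 → p * p < 15 * (r * r) →
    ∀ N → ∃ λ n → n > N × r * r * (count A n * count A n) > p * p * n
  infinitely-above p r _ p²<15r² N with attained N
  ... | n , N<n , c²≡15n = n , N<n , (begin-strict
    p * p * n                       <⟨ *-monoˡ-< n {{>-nonZero (≤-<-trans z≤n N<n)}} p²<15r² ⟩
    15 * (r * r) * n                ≡⟨ sym (rearrange r n) ⟩
    r * r * (15 * n)                ≡⟨ cong (r * r *_) (sym c²≡15n) ⟩
    r * r * (count A n * count A n) ∎)
    where open ≤-Reasoning

∃-complement-divisible : ∀ M .{{_ : NonZero M}} s → ∃ λ w → w ≤ M × M ∣ s + w
∃-complement-divisible M s = M ∸ s % M , m∸n≤m M (s % M) , divides (suc (s / M)) (begin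
  s + (M ∸ s % M)                   ≡⟨ cong (_+ (M ∸ s % M)) (m≡m%n+[m/n]*n s M) ⟩
  s % M + s / M * M + (M ∸ s % M)   ≡⟨ regroup (s % M) (s / M * M) (M ∸ s % M) ⟩
  s / M * M + (s % M + (M ∸ s % M)) ≡⟨ cong (s / M * M +_) (m+[n∸m]≡n (<⇒≤ (m%n<n s M))) ⟩
  s / M * M + M                     ≡⟨ +-comm (s / M * M) M ⟩
  suc (s / M) * M                   ∎)
  where
  open ≡-Reasoning
  regroup : ∀ r q w → r + q + w ≡ q + (r + w)
  regroup = solve-∀

-- t * i ≡ 1 (mod M) gives t * (u + w) + n ≡ t * (u + n * i + w) (mod M); choose w to make u + n * i + w divisible.
∃-congruence-solution : ∀ M .{{_ : NonZero M}} t i c → t * i ≡ 1 + M * c →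
  ∀ u n → ∃ λ w → w ≤ M × M ∣ t * (u + w) + n
∃-congruence-solution M t i c inverse u n with ∃-complement-divisible M (u + n * i)
... | w , w≤M , M∣u+ni+w = w , w≤M , ∣m+n∣m⇒∣n M∣sum (m∣m*n (n * c))
  where
  open ≡-Reasoning
  shift : M * (n * c) + (t * (u + w) + n) ≡ t * (u + n * i + w)
  shift = begin
    M * (n * c) + (t * (u + w) + n) ≡⟨ expand₁ t u w n M c ⟩
    t * (u + w) + n * (1 + M * c) ≡⟨ cong (λ z → t * (u + w) + n * z) (sym inverse) ⟩
    t * (u + w) + n * (t * i)     ≡⟨ expand₂ t u w n i ⟩
    t * (u + n * i + w)           ∎
    where
    expand₁ : ∀ t u w n M c → M * (n * c) + (t * (u + w) + n) ≡ t * (u + w) + n * (1 + M * c)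
    expand₁ = solve-∀
    expand₂ : ∀ t u w n i → t * (u + w) + n * (t * i) ≡ t * (u + n * i + w)
    expand₂ = solve-∀
  M∣sum : M ∣ M * (n * c) + (t * (u + w) + n)
  M∣sum = subst (M ∣_) (sym shift) (∣n⇒∣m*n t M∣u+ni+w)

greedy-count : ∀ (A : Seq) s u →
  (∀ j → j ≤ u → (suc (j + s) ∈ A ⇔ count A (j + s) < j)) →
  ∀ j → j ≤ u → j ≤ count A (suc (j + s)) × count A (suc (j + s)) ≤ count A s ⊔ j
greedy-count A s u rule zero 0≤u rewrite count-suc-∉ A s (λ ∈A → n≮0 (Equivalence.to (rule 0 0≤u) ∈A)) =
  z≤n , m≤m⊔n (count A s) 0
greedy-count A s u rule (suc j) 1+j≤u with greedy-count A s u rule j (<⇒≤ 1+j≤u)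
                                       | A (suc (suc j + s)) Bool.≟ true
... | j≤c , c≤c₀⊔j | yes ∈A rewrite count-suc-∈ A (suc j + s) ∈A =
  s≤s j≤c , ≤-trans (Equivalence.to (rule (suc j) 1+j≤u) ∈A) (m≤n⊔m (count A s) (suc j))
... | j≤c , c≤c₀⊔j | no ∉A rewrite count-suc-∉ A (suc j + s) ∉A =
  ≮⇒≥ (λ c<1+j → ∉A (Equivalence.from (rule (suc j) 1+j≤u) c<1+j)) ,
  ≤-trans c≤c₀⊔j (⊔-monoʳ-≤ (count A s) (n≤1+n j))

⊔-square-≤ : ∀ {a b B} → a * a ≤ B → b * b ≤ B → (a ⊔ b) * (a ⊔ b) ≤ B
⊔-square-≤ {a} {b} a²≤B b²≤B with ⊔-sel a b
... | inj₁ a⊔b≡a rewrite a⊔b≡a = a²≤B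
... | inj₂ a⊔b≡b rewrite a⊔b≡b = b²≤B

count-multiples-linear : ∀ (A : Seq) t .{{_ : NonZero t}} a d {n} → t * a ≤ n → count A (t * a) ≡ d + a →
  (∀ y → t * a < y → y ≤ n → y ∈ A → t ∣ y) → t * count A n ≤ t * d + n
count-multiples-linear A t a d {n} ta≤n count≡d+a multiples = begin
  t * count A n            ≤⟨ *-monoʳ-≤ t count≤ ⟩
  t * (d + n / t)          ≡⟨ *-distribˡ-+ t d (n / t) ⟩
  t * d + t * (n / t)      ≤⟨ +-monoʳ-≤ (t * d) (subst (_≤ n) (*-comm (n / t) t) (m/n*n≤m n t)) ⟩
  t * d + n                ∎
  where
  open ≤-Reasoning
  swap : ∀ a b c → a + b + c ≡ a + c + b
  swap = solve-∀
  count≤ : count A n ≤ d + n / t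
  count≤ = +-cancelʳ-≤ a _ _ (begin
    count A n + a            ≡⟨ cong (count A n +_) (sym (trans (/-congˡ (*-comm t a)) (m*n/n≡m a t))) ⟩
    count A n + t * a / t    ≤⟨ count-multiples A t ta≤n multiples ⟩
    count A (t * a) + n / t  ≡⟨ cong (_+ n / t) count≡d+a ⟩
    d + a + n / t            ≡⟨ swap d a (n / t) ⟩
    d + n / t + a            ∎)

cancel-square-scale : ∀ t .{{_ : NonZero t}} c n → (t * c) * (t * c) ≤ 15 * (t * t) * n → c * c ≤ 15 * n
cancel-square-scale t c n scaled = *-cancelˡ-≤ t (*-cancelˡ-≤ t (begin
  t * (t * (c * c))        ≡⟨ regroup₁ t c ⟩
  (t * c) * (t * c)        ≤⟨ scaled ⟩
  15 * (t * t) * n         ≡⟨ regroup₂ t n ⟩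
  t * (t * (15 * n))       ∎))
  where
  open ≤-Reasoning
  regroup₁ : ∀ t c → t * (t * (c * c)) ≡ (t * c) * (t * c)
  regroup₁ = solve-∀
  regroup₂ : ∀ t n → 15 * (t * t) * n ≡ t * (t * (15 * n))
  regroup₂ = solve-∀

-- The set 𝔸

scale : ℕ → ℕ
scale zero    = 0
scale (suc k) = next (scale k)

scale-mono : ∀ {j k} → j ≤ k → scale j ≤ scale k
scale-mono {k = zero}  z≤n    = ≤-refl
scale-mono {k = suc k} j≤1+k with m≤n⇒m<n∨m≡n j≤1+k
... | inj₁ (s≤s j≤k) = ≤-trans (scale-mono j≤k) (<⇒≤ (x<next (scale k)))
... | inj₂ refl      = ≤-refl

k≤scale : ∀ k → k ≤ scale k
k≤scale zero    = z≤n
k≤scale (suc k) = <-≤-trans (s≤s (k≤scale k)) (x<next (scale k))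

E≤μ : ∀ x → E x ≤ μ x
E≤μ x = subst (E x ≤_) (sym (μ≡1+U+ε x)) (s≤s (m≤n+m (ε x) (U x)))

lo≤hi : ∀ x → lo x ≤ hi x
lo≤hi x = *-monoʳ-≤ (τ x) (L≤H x)

E-mono : ∀ {j k} → j ≤ k → E (scale j) ≤ E (scale k)
E-mono j≤k = s≤s (eval-mono εₚ (scale-mono j≤k))

μ-mono : ∀ {j k} → j ≤ k → μ (scale j) ≤ μ (scale k)
μ-mono j≤k = eval-mono μₚ (scale-mono j≤k)

lo-mono : ∀ {x y} → x ≤ y → lo x ≤ lo y
lo-mono x≤y = *-mono-≤ (eval-mono τₚ x≤y) (eval-mono Lₚ x≤y)

hi<E-later : ∀ {j k} → j ≤ k → hi (scale j) < E (scale k)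
hi<E-later {j} j≤k = <-≤-trans (hi<E (scale j)) (E-mono j≤k)

μ<lo-later : ∀ {j k} → j < k → μ (scale j) < lo (scale k)
μ<lo-later {j} j<k = <-≤-trans (μ<lo-next (scale j)) (lo-mono (scale-mono j<k))

μ<E-later : ∀ {j k} → j < k → μ (scale j) < E (scale k)
μ<E-later {k = k} j<k = <-≤-trans (μ<lo-later j<k) (<⇒≤ (≤-<-trans (lo≤hi (scale k)) (hi<E (scale k))))

Block : ℕ → ℕ → Set
Block x y = lo x ≤ y × y ≤ hi x × τ x ∣ y

Window : ℕ → ℕ → Set
Window x y = E x ≤ y × y ≤ μ x

block? : ∀ x y → Dec (Block x y)
block? x y = (lo x ≤? y) ×-dec (y ≤? hi x) ×-dec (τ x ∣? y)

window? : ∀ x y → Dec (Window x y)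
window? x y = (E x ≤? y) ×-dec (y ≤? μ x)

-- c is the number of elements below y; a window position y is taken when c < y − E x.
Member : ℕ → ℕ → Set
Member c y = (∃ λ k → k < suc y × Block (scale k) y)
           ⊎ (∃ λ k → k < suc y × Window (scale k) y × c < y ∸ E (scale k))

member? : ∀ c y → Dec (Member c y)
member? c y = anyUpTo? (λ k → block? (scale k) y) (suc y)
         ⊎-dec anyUpTo? (λ k → window? (scale k) y ×-dec (c <? y ∸ E (scale k))) (suc y)

-- filled y and below y count the elements ≤ y and < y; they are computed together with 𝔸.
filled : ℕ → ℕ
filled zero    = if does (member? 0 0) then 1 else 0
filled (suc y) = if does (member? (filled y) (suc y)) then suc (filled y) else filled y

below : ℕ → ℕ
below zero    = 0
below (suc y) = filled y

𝔸 : Seq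
𝔸 y = does (member? (below y) y)

count-𝔸 : ∀ y → count 𝔸 y ≡ filled y
count-𝔸 zero with does (member? 0 0)
... | true  = refl
... | false = refl
count-𝔸 (suc y) with does (member? (filled y) (suc y))
... | true  = cong suc (count-𝔸 y)
... | false = count-𝔸 y

does-true⇒ : ∀ {P : Set} (p? : Dec P) → does p? ≡ true → P
does-true⇒ (yes p) _  = p
does-true⇒ (no _)  ()

∈𝔸⇔member : ∀ y → y ∈ 𝔸 ⇔ Member (below y) y
∈𝔸⇔member y = mk⇔ (does-true⇒ (member? (below y) y)) (dec-true (member? (below y) y))

block⊆𝔸 : ∀ k {y} → Block (scale k) y → y ∈ 𝔸
block⊆𝔸 k {y} b = Equivalence.from (∈𝔸⇔member y) (inj₁ (k , s≤s k≤y , b))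
  where
  k≤y : k ≤ y
  k≤y = ≤-trans (k≤scale k) (≤-trans (x≤lo (scale k)) (proj₁ b))

𝔸-below-window⊆block : ∀ k {y} → y ∈ 𝔸 → y < E (scale k) → (∀ {j} → j < k → μ (scale j) < y) →
                       Block (scale k) y
𝔸-below-window⊆block k {y} ∈𝔸 y<E after with Equivalence.to (∈𝔸⇔member y) ∈𝔸
... | inj₁ (j , _ , b@(lo≤y , y≤hi , _)) with <-cmp j k
...   | tri≈ _ refl _ = b
...   | tri< j<k _ _  =
  contradiction (after j<k) (≤⇒≯ (≤-trans y≤hi (<⇒≤ (<-≤-trans (hi<E (scale j)) (E≤μ (scale j))))))
...   | tri> _ _ k<j  =
  contradiction (<-≤-trans (≤-<-trans (E≤μ (scale k)) (μ<lo-later k<j)) lo≤y) (<⇒≯ y<E)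
𝔸-below-window⊆block k {y} ∈𝔸 y<E after | inj₂ (j , _ , (E≤y , y≤μ) , _) with <-≤-connex j k
... | inj₁ j<k = contradiction (after j<k) (≤⇒≯ y≤μ)
... | inj₂ k≤j = contradiction (≤-trans (E-mono k≤j) E≤y) (<⇒≱ y<E)

window-unique : ∀ {j k y} → Window (scale j) y → Window (scale k) y → j ≡ k
window-unique {j} {k} (Eⱼ≤y , y≤μⱼ) (Eₖ≤y , y≤μₖ) with <-cmp j k
... | tri≈ _ j≡k _ = j≡k
... | tri< j<k _ _ = contradiction (≤-<-trans y≤μⱼ (μ<E-later j<k)) (≤⇒≯ Eₖ≤y)
... | tri> _ _ k<j = contradiction (≤-<-trans y≤μₖ (μ<E-later k<j)) (≤⇒≯ Eⱼ≤y)

window-∈𝔸⇔ : ∀ k {y} → Window (scale k) y → (y ∈ 𝔸 ⇔ below y < y ∸ E (scale k))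
window-∈𝔸⇔ k {y} w@(E≤y , y≤μ) = mk⇔ taken (λ c< → Equivalence.from (∈𝔸⇔member y) (inj₂ (k , s≤s k≤y , w , c<)))
  where
  k≤y : k ≤ y
  k≤y = ≤-trans (k≤scale k) (≤-trans (x≤E (scale k)) E≤y)
  taken : y ∈ 𝔸 → below y < y ∸ E (scale k)
  taken ∈𝔸 with Equivalence.to (∈𝔸⇔member y) ∈𝔸
  ... | inj₂ (j , _ , wⱼ , c<) = subst (λ i → below y < y ∸ E (scale i)) (window-unique {j} {k} {y} wⱼ w) c<
  ... | inj₁ (j , _ , lo≤y , y≤hi , _) with ≤-<-connex j k
  ...   | inj₁ j≤k = contradiction (≤-<-trans y≤hi (hi<E-later j≤k)) (≤⇒≯ E≤y)
  ...   | inj₂ k<j = contradiction (≤-<-trans y≤μ (μ<lo-later k<j)) (≤⇒≯ lo≤y)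

-- Bounding the count

SquareBounded : ℕ → Set
SquareBounded n = count 𝔸 n * count 𝔸 n ≤ 15 * n

below-suc : ∀ y → below (suc y) ≡ count 𝔸 y
below-suc y = sym (count-𝔸 y)

module Window (k : ℕ) (c₀²≤15ε : SquareBounded (ε (scale k))) where
  x c₀ : ℕ
  x  = scale k
  c₀ = count 𝔸 (ε x)

  window-rule : ∀ j → j ≤ U x → (suc (j + ε x) ∈ 𝔸 ⇔ count 𝔸 (j + ε x) < j)
  window-rule j j≤U = subst₂ (λ c d → suc (j + ε x) ∈ 𝔸 ⇔ c < d) (below-suc (j + ε x)) (m+n∸n≡m j (ε x))
    (window-∈𝔸⇔ k (s≤s (m≤n+m (ε x) j) , subst (suc (j + ε x) ≤_) (sym (μ≡1+U+ε x)) (s≤s (+-monoˡ-≤ (ε x) j≤U))))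

  window-count : ∀ j → j ≤ U x → j ≤ count 𝔸 (suc (j + ε x)) × count 𝔸 (suc (j + ε x)) ≤ c₀ ⊔ j
  window-count = greedy-count 𝔸 (ε x) (U x) window-rule

  c₀<U : c₀ < U x
  c₀<U = ≰⇒> λ U≤c₀ → <⇒≱ c₀²<U² (*-mono-≤ U≤c₀ U≤c₀)
    where
    c₀²<U² : c₀ * c₀ < U x * U x
    c₀²<U² = begin-strict
      c₀ * c₀                  ≤⟨ c₀²≤15ε ⟩
      15 * ε x                 <⟨ *-monoʳ-< 15 (s≤s (m≤n+m (ε x) (U x))) ⟩
      15 * suc (U x + ε x)     ≡⟨ cong (15 *_) (sym (μ≡1+U+ε x)) ⟩
      15 * μ x                 ≡⟨ sym (U²≡15μ x) ⟩
      U x * U x                ∎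
      where open ≤-Reasoning

  peak : count 𝔸 (μ x) ≡ U x
  peak = subst (λ n → count 𝔸 n ≡ U x) (sym (μ≡1+U+ε x))
    (≤-antisym (≤-trans (proj₂ at-U) (≤-reflexive (m≤n⇒m⊔n≡n (<⇒≤ c₀<U)))) (proj₁ at-U))
    where
    at-U : U x ≤ count 𝔸 (suc (U x + ε x)) × count 𝔸 (suc (U x + ε x)) ≤ c₀ ⊔ U x
    at-U = window-count (U x) ≤-refl

  bounded : ∀ n → E x ≤ n → n ≤ μ x → SquareBounded n
  bounded n E≤n n≤μ with n ∸ E x | m∸n+n≡m E≤n
  ... | j | refl rewrite +-suc j (ε x) = ≤-trans (*-mono-≤ c≤c₀⊔j c≤c₀⊔j) (⊔-square-≤ {c₀} {j} c₀²≤ j²≤)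
    where
    j≤U : j ≤ U x
    j≤U = +-cancelʳ-≤ (ε x) j (U x) (≤-pred (subst (suc (j + ε x) ≤_) (μ≡1+U+ε x) n≤μ))
    c≤c₀⊔j : count 𝔸 (suc (j + ε x)) ≤ c₀ ⊔ j
    c≤c₀⊔j = proj₂ (window-count j j≤U)
    c₀²≤ : c₀ * c₀ ≤ 15 * suc (j + ε x)
    c₀²≤ = ≤-trans c₀²≤15ε (*-monoʳ-≤ 15 (≤-trans (m≤n+m (ε x) j) (n≤1+n _)))
    j²≤ : j * j ≤ 15 * suc (j + ε x)
    j²≤ = subst (λ m → j * j ≤ 15 * m) (trans (cong (_+ j) (ν*U≡E x)) (trans (+-comm (E x) j) (+-suc j (ε x))))
            (j²≤15[νU+j] (ν x) (U x) j (U≡15*[1+ν] x) j≤U)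

module Gap (k : ℕ) (peak : count 𝔸 (μ (scale k)) ≡ U (scale k)) where
  x x′ t q : ℕ
  x  = scale k
  x′ = next x
  t  = τ x′
  q  = t * α x

  instance
    t-nonZero : NonZero t
    t-nonZero = τ-nonZero x′

  gap⊆block : ∀ {y} → y ∈ 𝔸 → μ x < y → y < E x′ → Block x′ y
  gap⊆block ∈𝔸 μ<y y<E = 𝔸-below-window⊆block (suc k) ∈𝔸 y<E λ { (s≤s j≤k) → ≤-<-trans (μ-mono j≤k) μ<y }

  q<lo′ : q < lo x′
  q<lo′ = begin-strict
    t * α x         <⟨ m<n+m (t * α x) (τ-positive x′) ⟩
    t + t * α x     ≡⟨ sym (*-suc t (α x)) ⟩
    t * suc (α x)   ≡⟨ cong (t *_) (sym (L′≡1+α x)) ⟩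
    t * L x′        ∎
    where open ≤-Reasoning

  flat : ∀ n → μ x ≤ n → n ≤ q → count 𝔸 n ≡ U x
  flat n μ≤n n≤q = trans (count-unchanged 𝔸 μ≤n quiet) peak
    where
    quiet : ∀ y → μ x < y → y ≤ n → ¬ y ∈ 𝔸
    quiet y μ<y y≤n ∈𝔸 = <⇒≱ (≤-<-trans (≤-trans y≤n n≤q) q<lo′)
                              (proj₁ (gap⊆block ∈𝔸 μ<y (≤-<-trans (≤-trans y≤n n≤q) (τ′α<E′ x))))

  linear : ∀ n → q ≤ n → n < E x′ → t * count 𝔸 n ≤ t * δ x + n
  linear n q≤n n<E = count-multiples-linear 𝔸 t (α x) (δ x) q≤n (trans (flat q (μ≤τ′α x) ≤-refl) (U≡δ+α x))
    λ y q<y y≤n ∈𝔸 → proj₂ (proj₂ (gap⊆block ∈𝔸 (≤-<-trans (μ≤τ′α x) q<y) (≤-<-trans y≤n n<E)))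

  bounded : ∀ n → μ x ≤ n → n < E x′ → SquareBounded n
  bounded n μ≤n n<E with n ≤? q
  ... | yes n≤q = begin
    count 𝔸 n * count 𝔸 n    ≡⟨ cong (λ c → c * c) (flat n μ≤n n≤q) ⟩
    U x * U x                ≡⟨ U²≡15μ x ⟩
    15 * μ x                 ≤⟨ *-monoʳ-≤ 15 μ≤n ⟩
    15 * n                   ∎
    where open ≤-Reasoning
  ... | no  n≰q = cancel-square-scale t (count 𝔸 n) n (begin
    (t * count 𝔸 n) * (t * count 𝔸 n) ≤⟨ *-mono-≤ (linear n q≤n n<E) (linear n q≤n n<E) ⟩
    (t * δ x + n) * (t * δ x + n)     ≤⟨ square-bound-between (t * δ x) (15 * (t * t)) q≤n (<⇒≤ n<E)
                                           (quiet-start-bound x) (window-start-bound x) ⟩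
    15 * (t * t) * n                  ∎)
    where
    open ≤-Reasoning
    q≤n : q ≤ n
    q≤n = <⇒≤ (≰⇒> n≰q)

count-𝔸-zero : count 𝔸 0 ≡ 0
count-𝔸-zero = refl

initial-count≤ : ∀ n → n < E (scale zero) → count 𝔸 n ≤ n / τ 0
initial-count≤ n n<E = subst₂ _≤_ (+-identityʳ (count 𝔸 n)) (cong (_+ n / τ 0) count-𝔸-zero)
                         (count-multiples 𝔸 (τ 0) z≤n multiples)
  where
  multiples : ∀ y → 0 < y → y ≤ n → y ∈ 𝔸 → τ 0 ∣ y
  multiples y _ y≤n ∈𝔸 = proj₂ (proj₂ (𝔸-below-window⊆block 0 ∈𝔸 (≤-<-trans y≤n n<E) λ ()))

-- Written with scale zero rather than 0, and through a lemma over a variable n: otherwise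
-- conversion checking starts evaluating count 𝔸 at the seven-digit number ε (scale zero).
initial-bounded : SquareBounded (ε (scale zero))
initial-bounded = bounded-by-quotient (ε (scale zero)) ≤-refl
  (≤ᵇ⇒≤ (ε (scale zero) / τ 0 * (ε (scale zero) / τ 0)) (15 * ε (scale zero)) _)
  where
  bounded-by-quotient : ∀ n → n < E (scale zero) → n / τ 0 * (n / τ 0) ≤ 15 * n → SquareBounded n
  bounded-by-quotient n n<E = ≤-trans (*-mono-≤ (initial-count≤ n n<E) (initial-count≤ n n<E))

window-start-bounded : ∀ k → SquareBounded (ε (scale k))
window-start-bounded zero    = initial-bounded
window-start-bounded (suc k) = Gap.bounded k (Window.peak k (window-start-bounded k)) (ε (scale (suc k)))
  (≤-pred (μ<E-later (n<1+n k))) ≤-refl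

peak-count : ∀ k → count 𝔸 (μ (scale k)) ≡ U (scale k)
peak-count k = Window.peak k (window-start-bounded k)

bounded-between-peaks : ∀ k n → μ (scale k) ≤ n → n < μ (scale (suc k)) → SquareBounded n
bounded-between-peaks k n μₖ≤n n<μₖ₊₁ with n <? E (scale (suc k))
... | yes n<E = Gap.bounded k (peak-count k) n μₖ≤n n<E
... | no  n≮E = Window.bounded (suc k) (window-start-bounded (suc k)) n (≮⇒≥ n≮E) (<⇒≤ n<μₖ₊₁)

square-bounded : ∀ n → μ (scale 0) ≤ n → SquareBounded n
square-bounded n μ₀≤n =
  -- let rather than with: abstracting over μ₀≤n is extremely slow to check.
  let k , μₖ≤n , n<μₖ₊₁ = bracket (λ k → μ (scale k)) (λ k → ≤-<-trans (k≤scale k) (x<μ (scale k))) n μ₀≤n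
  in  bounded-between-peaks k n μₖ≤n n<μₖ₊₁

limsup : LimsupSqrt15 𝔸
limsup = limsup-sqrt15 𝔸 (μ (scale 0)) (λ n μ₀<n → square-bounded n (<⇒≤ μ₀<n))
  λ N → μ (scale N) , ≤-<-trans (k≤scale N) (x<μ (scale N))
      , trans (cong (λ c → c * c) (peak-count N)) (U²≡15μ (scale N))

-- Covering

module Cover (k n : ℕ) (β≤n : β (scale k) ≤ n) (n<β′ : n < β (scale (suc k))) where
  x x′ M : ℕ
  x  = scale k
  x′ = next x
  M  = 2 * τ x′

  instance
    M-nonZero : NonZero M
    M-nonZero = m*n≢0 2 (τ x′) {{_}} {{τ-nonZero x′}}

  solution : ∃ λ w → w ≤ M × M ∣ τ x * (u₀ x + w) + n
  solution = ∃-congruence-solution M (τ x) (ι x) (κ x) (τι≡1+2τ′κ x) (u₀ x) n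

  w u a₁ Z a₂ : ℕ
  w  = proj₁ solution
  u  = u₀ x + w
  a₁ = τ x * u
  Z  = (a₁ + n) / M
  a₂ = τ x′ * Z

  u≤u₀+M : u ≤ u₀ x + M
  u≤u₀+M = +-monoʳ-≤ (u₀ x) (proj₁ (proj₂ solution))

  MZ≡a₁+n : M * Z ≡ a₁ + n
  MZ≡a₁+n = m*[n/m]≡n (proj₂ (proj₂ solution))

  a₁+n≡2a₂ : a₁ + n ≡ 2 * a₂
  a₁+n≡2a₂ = trans (sym MZ≡a₁+n) (*-assoc 2 (τ x′) Z)

  a₁≤ : a₁ ≤ τ x * (u₀ x + M)
  a₁≤ = *-monoʳ-≤ (τ x) u≤u₀+M

  a₁<n : a₁ < n
  a₁<n = ≤-<-trans a₁≤ (<-≤-trans (τ[u₀+2τ′]<β x) β≤n)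

  a₁<a₂ : a₁ < a₂
  a₁<a₂ = *-cancelˡ-< 2 a₁ a₂ (begin-strict
    2 * a₁     ≡⟨ cong (a₁ +_) (+-identityʳ a₁) ⟩
    a₁ + a₁    <⟨ +-monoʳ-< a₁ a₁<n ⟩
    a₁ + n     ≡⟨ a₁+n≡2a₂ ⟩
    2 * a₂     ∎)
    where open ≤-Reasoning

  a₂<n : a₂ < n
  a₂<n = *-cancelˡ-< 2 a₂ n (begin-strict
    2 * a₂     ≡⟨ sym a₁+n≡2a₂ ⟩
    a₁ + n     <⟨ +-monoˡ-< n a₁<n ⟩
    n + n      ≡⟨ cong (n +_) (sym (+-identityʳ n)) ⟩
    2 * n      ∎)
    where open ≤-Reasoning

  a₁∈block : Block x a₁
  a₁∈block = *-monoʳ-≤ (τ x) (≤-trans (L≤u₀ x) (m≤m+n (u₀ x) w))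
           , *-monoʳ-≤ (τ x) (≤-trans u≤u₀+M (u₀+2τ′≤H x))
           , divides u (*-comm (τ x) u)

  a₂∈block : Block x′ a₂
  a₂∈block = *-monoʳ-≤ (τ x′) L′≤Z , *-monoʳ-≤ (τ x′) Z≤H′ , divides Z (*-comm (τ x′) Z)
    where
    open ≤-Reasoning
    L′≤Z : L x′ ≤ Z
    L′≤Z = *-cancelˡ-≤ M (begin
      M * L x′                 ≤⟨ 2τ′L′≤β+τu₀ x ⟩
      β x + τ x * u₀ x         ≤⟨ +-mono-≤ β≤n (*-monoʳ-≤ (τ x) (m≤m+n (u₀ x) w)) ⟩
      n + a₁                   ≡⟨ +-comm n a₁ ⟩
      a₁ + n                   ≡⟨ sym MZ≡a₁+n ⟩
      M * Z                    ∎)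
    Z≤H′ : Z ≤ H x′
    Z≤H′ = ≤-pred (subst (Z <_) (+-comm (H x′) 1) (*-cancelˡ-< M Z (H x′ + 1) (begin-strict
      M * Z                             ≡⟨ MZ≡a₁+n ⟩
      a₁ + n                            <⟨ +-mono-≤-< a₁≤ n<β′ ⟩
      τ x * (u₀ x + M) + β (next x)     ≡⟨ +-comm (τ x * (u₀ x + M)) (β x′) ⟩
      β x′ + τ x * (u₀ x + M)           ≤⟨ β′+τ[u₀+2τ′]≤2τ′[H′+1] x ⟩
      M * (H x′ + 1)                    ∎)))

covering : AP3-covering 𝔸
covering = β (scale 0) , λ n β₀<n →
  let k , βₖ≤n , n<βₖ₊₁ = bracket (λ k → β (scale k)) (λ k → ≤-<-trans (k≤scale k) (x<β (scale k))) n (<⇒≤ β₀<n)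
      open Cover k n βₖ≤n n<βₖ₊₁
  in  a₁ , a₂ , block⊆𝔸 k a₁∈block , block⊆𝔸 (suc k) a₂∈block , a₁<a₂ , a₂<n , a₁+n≡2a₂

theorem1p1 : ∃ λ (A : Seq) → AP3-covering A × LimsupSqrt15 A
theorem1p1 = 𝔸 , covering , limsup
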